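{- For every integer $n\ge0$, there is a bijection between the set of 2-dimensional faces of the $(n+1)$-dimensional hypercube and the set of permutations $\pi\in\mathcal{S}_{n+2}$ that avoid the pattern $2\text{ - }1\text{ - }3$ and have exactly one occurrence of the segmented pattern $312$.
   Context: $\mathcal{S}_m$ is the set of permutations of $\{1,\dots,m\}$ written as words $\pi_1\cdots\pi_m$. $\pi$ avoids $2\text{ - }1\text{ - }3$ if there are no indices $i<j<l$ with $\pi_j<\pi_i<\pi_l$. An occurrence of the segmented pattern $312$ in $\pi$ is an index $i$ with $\pi_{i+1}<\pi_{i+2}<\pi_i$. The $(n+1)$-dimensional hypercube has vertex set $\{0,1\}^{n+1}$, two vertices adjacent iff they differ in exactly one coordinate; a 2-dimensional face is a set of 4 vertices obtained by choosing two coordinate positions, letting them vary freely, and fixing all other coordinates to constant values in $\{0,1\}$. -}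

module Defs where

open import Data.Nat using (ℕ; suc; _<_; _+_)
open import Data.Fin using (Fin; toℕ)
open import Data.Bool using (Bool)
open import Data.Maybe using (Maybe; nothing; just)
open import Data.Vec using (Vec; []; _∷_; lookup)
open import Data.Vec.Relation.Unary.Unique.Propositional using (Unique)
open import Data.Product using (Σ; ∃; _×_)
open import Relation.Binary.PropositionalEquality using (_≡_)
open import Relation.Nullary using (¬_)

-- Words over {1..m} are represented with letters in Fin m (0-based);
-- order-pattern notions only depend on relative order, so this is harmless.

-- A permutation in S_m written as a word π₁⋯π_m : a length-m word
-- over Fin m with no repeated letter (hence a bijection).
IsPerm : ∀ {m} → Vec (Fin m) m → Set
IsPerm w = Unique w

Contains213 : ∀ {m} → Vec (Fin m) m → Set
Contains213 {m} π =
  Σ (Fin m) λ i → Σ (Fin m) λ j → Σ (Fin m) λ l →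
    (toℕ i < toℕ j) × (toℕ j < toℕ l) ×
    (toℕ (lookup π j) < toℕ (lookup π i)) × (toℕ (lookup π i) < toℕ (lookup π l))

Avoids213 : ∀ {m} → Vec (Fin m) m → Set
Avoids213 π = ¬ Contains213 π

Occ312 : ∀ {m} → Vec (Fin m) m → Fin m → Set
Occ312 {m} π a =
  Σ (Fin m) λ b → Σ (Fin m) λ c →
    (toℕ b ≡ suc (toℕ a)) × (toℕ c ≡ suc (toℕ b)) ×
    (toℕ (lookup π b) < toℕ (lookup π c)) × (toℕ (lookup π c) < toℕ (lookup π a))

ExactlyOne312 : ∀ {m} → Vec (Fin m) m → Set
ExactlyOne312 {m} π = Σ (Fin m) λ i → Occ312 π i × (∀ k → Occ312 π k → k ≡ i)

-- The set of π ∈ S_m avoiding 2-1-3 with exactly one 312 occurrence.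
-- Proof components are irrelevant, so elements are equal iff the words are.
record Perm213One312 (m : ℕ) : Set where
  constructor mkP
  field
    word      : Vec (Fin m) m
    .isPerm   : IsPerm word
    .avoids   : Avoids213 word
    .one312   : ExactlyOne312 word

-- 2-dimensional faces of the d-dimensional hypercube {0,1}^d, encoded
-- canonically by their "star vector": coordinate k is nothing if it is one
-- of the two free positions, and just b if it is fixed to b.
-- Such a vector determines the 4-vertex set and vice versa.
-- number of free (nothing) coordinates
freeCount : ∀ {d} → Vec (Maybe Bool) d → ℕ
freeCount [] = 0
freeCount (nothing ∷ v) = suc (freeCount v)
freeCount (just _ ∷ v) = freeCount v

record Face2 (d : ℕ) : Set where
  constructor mkF
  field
    star     : Vec (Maybe Bool) d
    .twoFree : freeCount star ≡ 2

{-# OPTIONS --safe #-}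
module Submission where

-- A 213-avoiding permutation π splits around its least letter as π = α′ 1 β′ with every
-- letter of α′ above every letter of β′ (otherwise x, 1, y with x < y would be a 2-1-3),
-- so π = α ⊖ (1 ⊕ β) with α and β again 213-avoiding.  The only segmented 312 that can
-- straddle the 1 is (last letter of α′, 1, first letter of β′), hence
-- occ₃₁₂(π) = occ₃₁₂(α) + occ₃₁₂(β) + [α and β are both nonempty].
-- So the 312-free avoiders of length n + 1 are exactly the words obtained from the letter 1 by
-- n steps L ↦ L ⊖ 1 or L ↦ 1 ⊕ L, i.e. the vertices of the n-cube, and the avoiders with one
-- 312 are obtained by such steps from α ⊖ (1 ⊕ β) with α, β nonempty and 312-free.  The latter
-- correspond to the 2-faces: the steps are the fixed coordinates before the first free one,
-- and α and β are the vertices given by the fixed coordinates between and after the two free ones.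

open import Defs
open import Data.Bool using (Bool; true; false; if_then_else_)
import Data.Bool.Properties as Bool
open import Data.Empty using (⊥; ⊥-elim)
open import Data.Fin using (Fin; toℕ) renaming (zero to fzero; suc to fsuc)
open import Data.Fin.Properties using (toℕ-injective; toℕ<n; toℕ-fromℕ<)
open import Data.Irrelevant using ([_])
open import Data.List
  using (List; []; _∷_; _++_; map; length; filter; upTo; foldr; catMaybes; drop)
open import Data.List.Properties
  using (length-++; length-map; length-upTo; map-∘; map-id-local; filter-all; filter-accept; filter-reject)
import Data.List.Properties as List
open import Data.List.Membership.Propositional using (_∈_)
open import Data.List.Membership.Propositional.Properties using (∈-upTo⁻; ∈-∃++)
open import Data.List.Relation.Binary.Disjoint.Propositional using (Disjoint)
open import Data.List.Relation.Unary.All as All using (All; []; _∷_)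
import Data.List.Relation.Unary.All.Properties as All
open import Data.List.Relation.Unary.AllPairs as AllPairs using ([]; _∷_)
open import Data.List.Relation.Unary.Any as Any using (Any; here; there)
import Data.List.Relation.Unary.Any.Properties as Any
open import Data.List.Relation.Unary.Unique.Propositional using (Unique)
import Data.List.Relation.Unary.Unique.Propositional.Properties as Unique
open import Data.Maybe using (Maybe; just; nothing)
import Data.Maybe.Properties as Maybe
open import Data.Nat
  using (ℕ; zero; suc; pred; NonZero; _+_; _∸_; _<_; _≤_; z≤n; s≤s; z<s; s<s; _<?_; _≟_)
open import Data.Nat.DivMod using (_mod_; m<n⇒m%n≡m)
open import Data.Nat.Properties
open import Data.List.Membership.DecPropositional _≟_ using (_∈?_)
open import Data.Product using (Σ; ∃-syntax; _×_; _,_; proj₁; proj₂)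
import Data.Product as Prod
open import Data.Refinement using (Refinement-syntax; _,_; value-injective)
import Data.Refinement as Refinement
open import Data.Sum using (_⊎_; inj₁; inj₂)
import Data.Sum as Sum
open import Data.Vec using (Vec; []; _∷_; fromList; toList; lookup; cast)
import Data.Vec as Vec
open import Data.Vec.Properties
  using (toList-cast; toList∘fromList; fromList∘toList; length-toList; toList-map; toList-injective; cast-is-id)
import Data.Vec.Relation.Unary.All.Properties as VecAll
open import Data.Vec.Relation.Unary.AllPairs using ([]; _∷_)
import Data.Vec.Relation.Unary.Unique.Propositional as Vec
open import Function using (_∘_; _⇔_; mk⇔; _↔_; mk↔ₛ′)
open import Function.Properties.Inverse using (↔-trans; ↔-sym)
open import Relation.Binary.PropositionalEquality
  using (_≡_; _≢_; refl; sym; trans; cong; cong₂; subst; module ≡-Reasoning)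
open import Relation.Nullary using (¬_; Dec; yes; no; does; contradiction)
open import Relation.Nullary.Decidable using (_×-dec_; dec-true; dec-false; does-⇔; recompute)
open import Relation.Unary using (Decidable)

-- 213-avoidance and segmented 312 in words over ℕ

Completes213 : ℕ → List ℕ → Set
Completes213 x []      = ⊥
Completes213 x (y ∷ L) = (y < x × Any (x <_) L) ⊎ Completes213 x L

Has213 : List ℕ → Set
Has213 []      = ⊥
Has213 (x ∷ L) = Completes213 x L ⊎ Has213 L

Starts312 : List ℕ → Set
Starts312 (x ∷ y ∷ z ∷ _) = y < z × z < x
Starts312 _               = ⊥

starts312? : Decidable Starts312
starts312? []              = no λ ()
starts312? (_ ∷ [])        = no λ ()
starts312? (_ ∷ _ ∷ [])    = no λ ()
starts312? (x ∷ y ∷ z ∷ _) = (y <? z) ×-dec (z <? x)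

indicator312 : List ℕ → ℕ
indicator312 L = if does (starts312? L) then 1 else 0

count312 : List ℕ → ℕ
count312 []      = 0
count312 (x ∷ L) = indicator312 (x ∷ L) + count312 L

count312-yes : ∀ x L → Starts312 (x ∷ L) → count312 (x ∷ L) ≡ suc (count312 L)
count312-yes x L s rewrite dec-true (starts312? (x ∷ L)) s = refl

count312-no : ∀ x L → ¬ Starts312 (x ∷ L) → count312 (x ∷ L) ≡ count312 L
count312-no x L ¬s rewrite dec-false (starts312? (x ∷ L)) ¬s = refl

Occurs312At : List ℕ → ℕ → Set
Occurs312At L k = Starts312 (drop k L)

ExactlyOne : (ℕ → Set) → Set
ExactlyOne P = ∃[ k ] P k × (∀ k′ → P k′ → k′ ≡ k)

count312≡0⇒no312 : ∀ L → count312 L ≡ 0 → ∀ k → ¬ Occurs312At L k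
count312≡0⇒no312 (x ∷ L) none zero    s = 1+n≢0 (trans (sym (count312-yes x L s)) none)
count312≡0⇒no312 (x ∷ L) none (suc k) =
  count312≡0⇒no312 L (m+n≡0⇒n≡0 (indicator312 (x ∷ L)) none) k

no312⇒count312≡0 : ∀ L → (∀ k → ¬ Occurs312At L k) → count312 L ≡ 0
no312⇒count312≡0 []      _    = refl
no312⇒count312≡0 (x ∷ L) none = trans (count312-no x L (none 0)) (no312⇒count312≡0 L (none ∘ suc))

count312≡1⇒unique312 : ∀ L → count312 L ≡ 1 → ExactlyOne (Occurs312At L)
count312≡1⇒unique312 (x ∷ L) one = from-head (starts312? (x ∷ L))
  where
  from-head : Dec (Starts312 (x ∷ L)) → ExactlyOne (Occurs312At (x ∷ L))
  from-head (yes s) = 0 , s , λ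
    { zero     _  → refl
    ; (suc k′) s′ → ⊥-elim (count312≡0⇒no312 L none k′ s′)
    }
    where
    none : count312 L ≡ 0
    none = suc-injective (trans (sym (count312-yes x L s)) one)
  from-head (no ¬s) =
    let k , s , unique = count312≡1⇒unique312 L (trans (sym (count312-no x L ¬s)) one)
    in suc k , s , λ { zero s′ → ⊥-elim (¬s s′) ; (suc k′) s′ → cong suc (unique k′ s′) }

unique312⇒count312≡1 : ∀ L → ExactlyOne (Occurs312At L) → count312 L ≡ 1
unique312⇒count312≡1 (x ∷ L) (zero , s , unique) =
  trans (count312-yes x L s)
        (cong suc (no312⇒count312≡0 L λ k′ s′ → 1+n≢0 (unique (suc k′) s′)))
unique312⇒count312≡1 (x ∷ L) (suc k , s , unique) =
  trans (count312-no x L λ s₀ → 1+n≢0 (sym (unique 0 s₀)))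
        (unique312⇒count312≡1 L (k , s , λ k′ s′ → suc-injective (unique (suc k′) s′)))

_≫_ : List ℕ → List ℕ → Set
A ≫ B = All (λ x → All (_< x) B) A

record AvoidingPerm (L : List ℕ) : Set where
  constructor mkAvoidingPerm
  field
    unique  : Unique L
    bounded : All (_< length L) L
    avoids  : ¬ Has213 L

module OrderEmbedding (f : ℕ → ℕ) (mono : ∀ {x y} → x < y → f x < f y)
                      (reflects : ∀ {x y} → f x < f y → x < y) where

  Completes213-map⁺ : ∀ x L → Completes213 x L → Completes213 (f x) (map f L)
  Completes213-map⁺ x (y ∷ L) (inj₁ (y<x , x<L)) = inj₁ (mono y<x , Any.map⁺ (Any.map mono x<L))
  Completes213-map⁺ x (y ∷ L) (inj₂ c)           = inj₂ (Completes213-map⁺ x L c)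

  Completes213-map⁻ : ∀ x L → Completes213 (f x) (map f L) → Completes213 x L
  Completes213-map⁻ x (y ∷ L) (inj₁ (y<x , x<L)) =
    inj₁ (reflects y<x , Any.map reflects (Any.map⁻ x<L))
  Completes213-map⁻ x (y ∷ L) (inj₂ c)           = inj₂ (Completes213-map⁻ x L c)

  Has213-map⁺ : ∀ L → Has213 L → Has213 (map f L)
  Has213-map⁺ (x ∷ L) = Sum.map (Completes213-map⁺ x L) (Has213-map⁺ L)

  Has213-map⁻ : ∀ L → Has213 (map f L) → Has213 L
  Has213-map⁻ (x ∷ L) = Sum.map (Completes213-map⁻ x L) (Has213-map⁻ L)

  Starts312-map : ∀ L → Starts312 L ⇔ Starts312 (map f L)
  Starts312-map []              = mk⇔ (λ ()) (λ ())
  Starts312-map (_ ∷ [])        = mk⇔ (λ ()) (λ ())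
  Starts312-map (_ ∷ _ ∷ [])    = mk⇔ (λ ()) (λ ())
  Starts312-map (x ∷ y ∷ z ∷ _) =
    mk⇔ (λ (y<z , z<x) → mono y<z , mono z<x) (λ (y<z , z<x) → reflects y<z , reflects z<x)

  count312-map : ∀ L → count312 (map f L) ≡ count312 L
  count312-map []      = refl
  count312-map (x ∷ L) = cong₂ _+_ indicator312-map (count312-map L)
    where
    indicator312-map : indicator312 (map f (x ∷ L)) ≡ indicator312 (x ∷ L)
    indicator312-map =
      cong (λ b → if b then 1 else 0) (sym (does-⇔ (Starts312-map (x ∷ L)) (starts312? _) (starts312? _)))

module Shift (k : ℕ) = OrderEmbedding (k +_) (+-monoʳ-< k) (+-cancelˡ-< k _ _)

Completes213-++⁺ˡ : ∀ {x} A {C} → Completes213 x A → Completes213 x (A ++ C)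
Completes213-++⁺ˡ (y ∷ A) (inj₁ (y<x , x<A)) = inj₁ (y<x , Any.++⁺ˡ x<A)
Completes213-++⁺ˡ (y ∷ A) (inj₂ c)           = inj₂ (Completes213-++⁺ˡ A c)

Completes213-++⁺ʳ : ∀ {x} A {C} → Completes213 x C → Completes213 x (A ++ C)
Completes213-++⁺ʳ []      c = c
Completes213-++⁺ʳ (y ∷ A) c = inj₂ (Completes213-++⁺ʳ A c)

Has213-++⁺ˡ : ∀ A {C} → Has213 A → Has213 (A ++ C)
Has213-++⁺ˡ (x ∷ A) = Sum.map (Completes213-++⁺ˡ A) (Has213-++⁺ˡ A)

Has213-++⁺ʳ : ∀ A {C} → Has213 C → Has213 (A ++ C)
Has213-++⁺ʳ []      h = h
Has213-++⁺ʳ (x ∷ A) h = inj₂ (Has213-++⁺ʳ A h)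

¬Any-< : ∀ {x C} → All (_< x) C → ¬ Any (x <_) C
¬Any-< C<x = All.All¬⇒¬Any (All.map (λ c<x x<c → <-asym c<x x<c) C<x)

¬Completes213-< : ∀ {x} C → All (_< x) C → ¬ Completes213 x C
¬Completes213-< (y ∷ C) (_ ∷ C<x) (inj₁ (_ , x<C)) = ¬Any-< C<x x<C
¬Completes213-< (y ∷ C) (_ ∷ C<x) (inj₂ c)         = ¬Completes213-< C C<x c

¬Completes213-0 : ∀ C → ¬ Completes213 0 C
¬Completes213-0 (y ∷ C) (inj₂ c) = ¬Completes213-0 C c

Completes213-++⁻ : ∀ {x} A {C} → All (_< x) C → Completes213 x (A ++ C) → Completes213 x A
Completes213-++⁻ []      C<x c        = ⊥-elim (¬Completes213-< _ C<x c)
Completes213-++⁻ (y ∷ A) C<x (inj₂ c) = inj₂ (Completes213-++⁻ A C<x c)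
Completes213-++⁻ (y ∷ A) C<x (inj₁ (y<x , x<AC)) with Any.++⁻ A x<AC
... | inj₁ x<A = inj₁ (y<x , x<A)
... | inj₂ x<C = ⊥-elim (¬Any-< C<x x<C)

Has213-++⁻ : ∀ A {C} → A ≫ C → Has213 (A ++ C) → Has213 A ⊎ Has213 C
Has213-++⁻ []      _           h        = inj₂ h
Has213-++⁻ (x ∷ A) (C<x ∷ _)   (inj₁ c) = inj₁ (inj₁ (Completes213-++⁻ A C<x c))
Has213-++⁻ (x ∷ A) (_   ∷ A≫C) (inj₂ h) = Sum.map₁ inj₂ (Has213-++⁻ A A≫C h)

≫⇒Disjoint : ∀ {A C} → A ≫ C → Disjoint A C
≫⇒Disjoint A≫C (v∈A , v∈C) = <-irrefl refl (All.lookup (All.lookup A≫C v∈A) v∈C)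

seam : List ℕ → List ℕ → ℕ
seam (_ ∷ _) (_ ∷ _) = 1
seam _       _       = 0

seam-∷ : ∀ x y A B → seam (x ∷ y ∷ A) B ≡ seam (y ∷ A) B
seam-∷ _ _ _ []      = refl
seam-∷ _ _ _ (_ ∷ _) = refl

seam-[]ʳ : ∀ α → seam α [] ≡ 0
seam-[]ʳ []      = refl
seam-[]ʳ (_ ∷ _) = refl

seam-map : ∀ f g α β → seam (map f α) (map g β) ≡ seam α β
seam-map f g []      β       = refl
seam-map f g (_ ∷ _) []      = refl
seam-map f g (_ ∷ _) (_ ∷ _) = refl

¬Starts312-0∷ : ∀ L → ¬ Starts312 (0 ∷ L)
¬Starts312-0∷ (_ ∷ _ ∷ _) (_ , ())

¬Starts312-∷∷0 : ∀ x y L → ¬ Starts312 (x ∷ y ∷ 0 ∷ L)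
¬Starts312-∷∷0 _ _ _ (() , _)

count312-++0∷ : ∀ A B → A ≫ B → All (0 <_) B →
                count312 (A ++ 0 ∷ B) ≡ count312 A + (seam A B + count312 B)
count312-++0∷ []        B       _                _         = count312-no 0 B (¬Starts312-0∷ B)
count312-++0∷ (x ∷ [])  []      _                _         = refl
count312-++0∷ (x ∷ [])  (b ∷ B) ((b<x ∷ _) ∷ []) (0<b ∷ _) =
  trans (count312-yes x (0 ∷ b ∷ B) (0<b , b<x))
        (cong suc (count312-no 0 (b ∷ B) (¬Starts312-0∷ (b ∷ B))))
count312-++0∷ (x ∷ y ∷ []) B (_ ∷ A≫B) 0<B rewrite seam-∷ x y [] B =
  trans (count312-no x (y ∷ 0 ∷ B) (¬Starts312-∷∷0 x y B)) (count312-++0∷ (y ∷ []) B A≫B 0<B)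
count312-++0∷ (x ∷ y ∷ z ∷ A) B (_ ∷ A≫B) 0<B rewrite seam-∷ x y (z ∷ A) B =
  trans (cong (indicator312 (x ∷ y ∷ z ∷ A) +_) (count312-++0∷ (y ∷ z ∷ A) B A≫B 0<B))
        (sym (+-assoc (indicator312 (x ∷ y ∷ z ∷ A)) (count312 (y ∷ z ∷ A)) _))

-- Decomposition around the least letter

-- The skew sum α ⊖ (1 ⊕ β), with letters counted from 0.
join : List ℕ → List ℕ → List ℕ
join α β = map (suc (length β) +_) α ++ 0 ∷ map suc β

length-join : ∀ α β → length (join α β) ≡ length α + suc (length β)
length-join α β =
  trans (length-++ (map _ α)) (cong₂ (λ a b → a + suc b) (length-map _ α) (length-map suc β))

join-≫ : ∀ α β → All (_< length β) β → map (suc (length β) +_) α ≫ (0 ∷ map suc β)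
join-≫ α β β< = All.map⁺ (All.universal below α)
  where
  below : ∀ a → All (_< suc (length β) + a) (0 ∷ map suc β)
  below a = z<s ∷ All.map⁺ (All.map (λ b< → s<s (<-≤-trans b< (m≤m+n _ a))) β<)

count312-join : ∀ α β → All (_< length β) β →
                count312 (join α β) ≡ count312 α + (seam α β + count312 β)
count312-join α β β< = begin
  count312 (join α β)
    ≡⟨ count312-++0∷ (map k+ α) (map suc β) (All.map All.tail (join-≫ α β β<))
                     (All.map⁺ (All.universal (λ _ → z<s) β)) ⟩
  count312 (map k+ α) + (seam (map k+ α) (map suc β) + count312 (map suc β))
    ≡⟨ cong₂ _+_ (Shift.count312-map k α)
                 (cong₂ _+_ (seam-map k+ suc α β) (Shift.count312-map 1 β)) ⟩
  count312 α + (seam α β + count312 β) ∎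
  where
  open ≡-Reasoning
  k : ℕ
  k = suc (length β)
  k+ : ℕ → ℕ
  k+ = k +_

join-avoidingPerm : ∀ {α β} → AvoidingPerm α → AvoidingPerm β → AvoidingPerm (join α β)
join-avoidingPerm {α} {β} (mkAvoidingPerm uα α< ¬α) (mkAvoidingPerm uβ β< ¬β) =
  mkAvoidingPerm unique bounded avoids
  where
  unique : Unique (join α β)
  unique = Unique.++⁺ (Unique.map⁺ (+-cancelˡ-≡ _ _ _) uα)
                      (All.map⁺ (All.universal (λ _ ()) β) ∷ Unique.map⁺ suc-injective uβ)
                      (≫⇒Disjoint (join-≫ α β β<))
  n : ℕ
  n = length α + suc (length β)
  shifted-α< : ∀ {a} → a < length α → suc (length β) + a < n
  shifted-α< {a} a< = subst (suc (length β) + a <_) (+-comm _ (length α)) (+-monoʳ-< _ a<)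
  shifted-β< : ∀ {b} → b < length β → suc b < n
  shifted-β< b< = <-≤-trans (s<s b<) (m≤n+m _ _)
  bounded : All (_< length (join α β)) (join α β)
  bounded = subst (λ m → All (_< m) (join α β)) (sym (length-join α β))
    (All.++⁺ (All.map⁺ (All.map shifted-α< α<))
             (<-≤-trans z<s (m≤n+m _ _) ∷ All.map⁺ (All.map shifted-β< β<)))
  avoids : ¬ Has213 (join α β)
  avoids h with Has213-++⁻ (map _ α) (join-≫ α β β<) h
  ... | inj₁ hα        = ¬α (Shift.Has213-map⁻ _ α hα)
  ... | inj₂ (inj₁ c)  = ¬Completes213-0 (map suc β) c
  ... | inj₂ (inj₂ hβ) = ¬β (Shift.Has213-map⁻ 1 β hβ)

join≢[] : ∀ α β → join α β ≢ []
join≢[] []      _ ()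
join≢[] (_ ∷ _) _ ()

Unique-++⁻ : ∀ {X : Set} (A C : List X) → Unique (A ++ C) → Unique A × Unique C
Unique-++⁻ []      C u         = [] , u
Unique-++⁻ (x ∷ A) C (x∉ ∷ u) =
  let uA , uC = Unique-++⁻ A C u in (proj₁ (All.++⁻ A x∉) ∷ uA) , uC

pigeonhole : ∀ c {L} → Unique L → All (_< c) L → length L ≤ c
pigeonhole zero    {[]}    _ _        = z≤n
pigeonhole zero    {_ ∷ _} _ (() ∷ _)
pigeonhole (suc c) {L}     u L<1+c    =
  ≤-trans (length≤1+filter u L<1+c)
          (s≤s (pigeonhole c (Unique.filter⁺ (_<? c) u) (All.all-filter (_<? c) L)))
  where
  length≤1+filter : ∀ {L} → Unique L → All (_< suc c) L → length L ≤ suc (length (filter (_<? c) L))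
  length≤1+filter {[]}    _         _               = z≤n
  length≤1+filter {x ∷ L} (x∉L ∷ u) (x<1+c ∷ L<1+c) with x <? c
  ... | yes x<c = ≤-trans (s≤s (length≤1+filter u L<1+c))
                          (≤-reflexive (cong (suc ∘ length) (sym (filter-accept (_<? c) x<c))))
  ... | no  x≮c = ≤-reflexive (cong (suc ∘ length)
                                    (sym (trans (filter-reject (_<? c) x≮c) (filter-all (_<? c) L<c))))
    where
    x≡c : x ≡ c
    x≡c = ≤-antisym (≤-pred x<1+c) (≮⇒≥ x≮c)
    L<c : All (_< c) L
    L<c = All.zipWith (λ (x≢y , y<1+c) → ≤∧≢⇒< (≤-pred y<1+c) (x≢y ∘ trans x≡c ∘ sym))
                      (x∉L , L<1+c)

-- Prefixing L with 0, …, lo ∸ 1 reduces this to the pigeonhole principle.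
pigeonhole-interval : ∀ {lo hi L} → lo ≤ hi → Unique L → All (lo ≤_) L → All (_< hi) L →
                      lo + length L ≤ hi
pigeonhole-interval {lo} {hi} {L} lo≤hi u lo≤L L<hi =
  subst (_≤ hi) (trans (length-++ (upTo lo)) (cong (_+ length L) (length-upTo lo)))
    (pigeonhole hi (Unique.++⁺ (Unique.upTo⁺ lo) u
                               (λ (v∈ , v∈L) → <⇒≱ (∈-upTo⁻ v∈) (All.lookup lo≤L v∈L)))
                   (All.++⁺ (All.map (λ i<lo → <-≤-trans i<lo lo≤hi) (All.all-upTo lo)) L<hi))

shift-unshift : ∀ k {A} → All (k ≤_) A → map (k +_) (map (_∸ k) A) ≡ A
shift-unshift k {A} k≤A = trans (sym (map-∘ A)) (map-id-local (All.map m+[n∸m]≡n k≤A))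

unshift-shift : ∀ k A → map (_∸ k) (map (k +_) A) ≡ A
unshift-shift k A = trans (sym (map-∘ A)) (map-id-local (All.universal (m+n∸m≡n k) A))

join-unshift : ∀ A B → All (suc (length B) ≤_) A → All (1 ≤_) B →
               join (map (_∸ suc (length B)) A) (map (_∸ 1) B) ≡ A ++ 0 ∷ B
join-unshift A B k≤A 1≤B =
  cong₂ (λ A′ B′ → A′ ++ 0 ∷ B′)
        (trans (cong (λ b → map (suc b +_) (map (_∸ suc (length B)) A)) (length-map _ B))
               (shift-unshift _ k≤A))
        (shift-unshift 1 1≤B)

unshift-avoidingPerm : ∀ k {A} → All (k ≤_) A → All (_< k + length A) A → Unique A → ¬ Has213 A →
                       AvoidingPerm (map (_∸ k) A)
unshift-avoidingPerm k {A} k≤A A<k+n u ¬h =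
  mkAvoidingPerm (Unique.map⁻ (subst Unique (sym shifted) u))
                 (subst (λ n → All (_< n) (map (_∸ k) A)) (sym (length-map _ A))
                        (All.map⁺ (All.zipWith below (k≤A , A<k+n))))
                 (¬h ∘ subst Has213 shifted ∘ Shift.Has213-map⁺ k _)
  where
  shifted : map (k +_) (map (_∸ k) A) ≡ A
  shifted = shift-unshift k k≤A
  below : ∀ {x} → k ≤ x × x < k + length A → x ∸ k < length A
  below (k≤x , x<) = +-cancelˡ-< k _ _ (subst (_< k + length A) (sym (m+[n∸m]≡n k≤x)) x<)

zero∈ : ∀ {L} → AvoidingPerm L → 0 < length L → 0 ∈ L
zero∈ {L} (mkAvoidingPerm u L<n _) 0<n with 0 ∈? L
... | yes 0∈L = 0∈L
... | no  0∉L = contradiction (pigeonhole-interval 0<n u 1≤L L<n) (<-irrefl refl)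
  where
  1≤L : All (1 ≤_) L
  1≤L = All.map (λ 0≢x → n≢0⇒n>0 (0≢x ∘ sym)) (All.¬Any⇒All¬ L 0∉L)

≫-around-0 : ∀ A {B} → Unique (A ++ 0 ∷ B) → ¬ Has213 (A ++ 0 ∷ B) → A ≫ (0 ∷ B)
≫-around-0 []          _         _    = []
≫-around-0 (x ∷ A) {B} (x∉ ∷ u) ¬213 = (0<x ∷ B<x) ∷ ≫-around-0 A u (¬213 ∘ inj₂)
  where
  x≢0B : All (x ≢_) (0 ∷ B)
  x≢0B = proj₂ (All.++⁻ A x∉)
  0<x : 0 < x
  0<x = n≢0⇒n>0 (All.head x≢0B)
  x≮B : ¬ Any (x <_) B
  x≮B x<B = ¬213 (inj₁ (Completes213-++⁺ʳ A (inj₁ (0<x , x<B))))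
  B<x : All (_< x) B
  B<x = All.zipWith (λ (x≢y , x≮y) → ≤∧≢⇒< (≮⇒≥ x≮y) (x≢y ∘ sym))
                    (All.tail x≢0B , All.¬Any⇒All¬ B x≮B)

-- Both by pigeonhole: 0 ∷ B lies below each x ∈ A, and A lies above each y ∈ B.
around-0-ranges : ∀ A {B} → Unique (A ++ 0 ∷ B) → All (_< length A + suc (length B)) (A ++ 0 ∷ B) →
                  A ≫ (0 ∷ B) → All (suc (length B) ≤_) A × All (_< suc (length B)) B
around-0-ranges A {B} u L<n A≫0B =
  All.map (λ {x} 0B<x → pigeonhole x u0B 0B<x) A≫0B , All.tabulate (s≤s ∘ ≤length)
  where
  uA : Unique A
  uA = proj₁ (Unique-++⁻ A (0 ∷ B) u)
  u0B : Unique (0 ∷ B)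
  u0B = proj₂ (Unique-++⁻ A (0 ∷ B) u)
  A<n : All (_< length A + suc (length B)) A
  A<n = proj₁ (All.++⁻ A L<n)
  B<n : All (_< length A + suc (length B)) B
  B<n = All.tail (proj₂ (All.++⁻ A L<n))
  ≤length : ∀ {y} → y ∈ B → y ≤ length B
  ≤length y∈B =
    ≤-pred (+-cancelˡ-≤ (length A) _ _ (subst (_≤ length A + suc (length B)) (+-comm _ (length A))
      (pigeonhole-interval (All.lookup B<n y∈B) uA
                           (All.map (λ 0B<x → All.lookup 0B<x (there y∈B)) A≫0B) A<n)))

data JoinView : List ℕ → Set where
  join-view : ∀ {α β} → AvoidingPerm α → AvoidingPerm β → JoinView (join α β)

joinView : ∀ {L} → AvoidingPerm L → 0 < length L → JoinView L
joinView {L} p 0<n with ∈-∃++ (zero∈ p 0<n)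
... | A , B , refl =
  subst JoinView (join-unshift A B k≤A 1≤B)
    (join-view (unshift-avoidingPerm k k≤A (subst (λ n → All (_< n) A) (+-comm (length A) k) A<n) uA
                                     (avoids ∘ Has213-++⁺ˡ A))
               (unshift-avoidingPerm 1 1≤B B<k uB (avoids ∘ Has213-++⁺ʳ A ∘ inj₂)))
  where
  open AvoidingPerm p
  k : ℕ
  k = suc (length B)
  L<n : All (_< length A + k) (A ++ 0 ∷ B)
  L<n = subst (λ n → All (_< n) (A ++ 0 ∷ B)) (length-++ A) bounded
  uA : Unique A
  uA = proj₁ (Unique-++⁻ A (0 ∷ B) unique)
  u0B : Unique (0 ∷ B)
  u0B = proj₂ (Unique-++⁻ A (0 ∷ B) unique)
  uB : Unique B
  uB = AllPairs.tail u0B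
  ranges : All (k ≤_) A × All (_< k) B
  ranges = around-0-ranges A unique L<n (≫-around-0 A unique avoids)
  k≤A : All (k ≤_) A
  k≤A = proj₁ ranges
  B<k : All (_< k) B
  B<k = proj₂ ranges
  A<n : All (_< length A + k) A
  A<n = proj₁ (All.++⁻ A L<n)
  1≤B : All (1 ≤_) B
  1≤B = All.map (λ 0≢y → n≢0⇒n>0 (0≢y ∘ sym)) (AllPairs.head u0B)

splitAtZero : List ℕ → List ℕ × List ℕ
splitAtZero []          = [] , []
splitAtZero (zero ∷ L)  = [] , L
splitAtZero (suc x ∷ L) = Prod.map₁ (suc x ∷_) (splitAtZero L)

splitAtZero-++ : ∀ A {B} → All (0 <_) A → splitAtZero (A ++ 0 ∷ B) ≡ (A , B)
splitAtZero-++ []          _         = refl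
splitAtZero-++ (suc x ∷ A) (_ ∷ 0<A) = cong (Prod.map₁ (suc x ∷_)) (splitAtZero-++ A 0<A)

unjoin : List ℕ → List ℕ × List ℕ
unjoin L = let A , B = splitAtZero L in map (_∸ suc (length B)) A , map (_∸ 1) B

unjoin-join : ∀ α β → unjoin (join α β) ≡ (α , β)
unjoin-join α β
  rewrite splitAtZero-++ (map (suc (length β) +_) α) {map suc β}
                         (All.map⁺ (All.universal (λ _ → z<s) α))
        | length-map suc β
  = cong₂ _,_ (unshift-shift _ α) (unshift-shift 1 β)

-- Vertices and 2-faces of the cube as words

step : Bool → List ℕ → List ℕ
step true  L = join L []
step false L = join [] L

steps : List Bool → List ℕ → List ℕ
steps u L = foldr step L u

vertex : List Bool → List ℕ
vertex v = steps v (0 ∷ [])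

faceWord : List Bool → List Bool → List Bool → List ℕ
faceWord u p q = steps u (join (vertex p) (vertex q))

avoidingPerm-[] : AvoidingPerm []
avoidingPerm-[] = mkAvoidingPerm [] [] λ ()

avoidingPerm-[0] : AvoidingPerm (0 ∷ [])
avoidingPerm-[0] = mkAvoidingPerm ([] ∷ []) (z<s ∷ []) λ { (inj₁ ()) ; (inj₂ ()) }

length-step : ∀ b L → length (step b L) ≡ suc (length L)
length-step true  L = trans (length-join L []) (+-comm (length L) 1)
length-step false L = length-join [] L

step-avoidingPerm : ∀ b {L} → AvoidingPerm L → AvoidingPerm (step b L)
step-avoidingPerm true  p = join-avoidingPerm p avoidingPerm-[]
step-avoidingPerm false p = join-avoidingPerm avoidingPerm-[] p

count312-step : ∀ b {L} → AvoidingPerm L → count312 (step b L) ≡ count312 L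
count312-step true  {L} _ = begin
  count312 (join L [])          ≡⟨ count312-join L [] [] ⟩
  count312 L + (seam L [] + 0)  ≡⟨ cong (λ n → count312 L + (n + 0)) (seam-[]ʳ L) ⟩
  count312 L + 0                ≡⟨ +-identityʳ _ ⟩
  count312 L                    ∎
  where open ≡-Reasoning
count312-step false {L} p = count312-join [] L (AvoidingPerm.bounded p)

step≢[] : ∀ b L → step b L ≢ []
step≢[] true  L = join≢[] L []
step≢[] false L = join≢[] [] L

length-steps : ∀ u L → length (steps u L) ≡ length u + length L
length-steps []      L = refl
length-steps (b ∷ u) L = trans (length-step b (steps u L)) (cong suc (length-steps u L))

steps-avoidingPerm : ∀ u {L} → AvoidingPerm L → AvoidingPerm (steps u L)
steps-avoidingPerm []      p = p
steps-avoidingPerm (b ∷ u) p = step-avoidingPerm b (steps-avoidingPerm u p)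

count312-steps : ∀ u {L} → AvoidingPerm L → count312 (steps u L) ≡ count312 L
count312-steps []      p = refl
count312-steps (b ∷ u) p = trans (count312-step b (steps-avoidingPerm u p)) (count312-steps u p)

length-vertex : ∀ v → length (vertex v) ≡ suc (length v)
length-vertex v = trans (length-steps v (0 ∷ [])) (+-comm (length v) 1)

vertex-avoidingPerm : ∀ v → AvoidingPerm (vertex v)
vertex-avoidingPerm v = steps-avoidingPerm v avoidingPerm-[0]

count312-vertex : ∀ v → count312 (vertex v) ≡ 0
count312-vertex v = count312-steps v avoidingPerm-[0]

vertex≢[] : ∀ v → vertex v ≢ []
vertex≢[] []      ()
vertex≢[] (b ∷ v) = step≢[] b (vertex v)

count312-split : ∀ α β → All (_< length β) β → α ≢ [] → β ≢ [] →
                 count312 (join α β) ≡ suc (count312 α + count312 β)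
count312-split []      _       _  α≢[] _    = ⊥-elim (α≢[] refl)
count312-split (_ ∷ _) []      _  _    β≢[] = ⊥-elim (β≢[] refl)
count312-split (a ∷ α) (b ∷ β) β< _    _    = trans (count312-join (a ∷ α) (b ∷ β) β<) (+-suc _ _)

faceWord-avoidingPerm : ∀ u p q → AvoidingPerm (faceWord u p q)
faceWord-avoidingPerm u p q =
  steps-avoidingPerm u (join-avoidingPerm (vertex-avoidingPerm p) (vertex-avoidingPerm q))

count312-faceWord : ∀ u p q → count312 (faceWord u p q) ≡ 1
count312-faceWord u p q = begin
  count312 (faceWord u p q)
    ≡⟨ count312-steps u (join-avoidingPerm (vertex-avoidingPerm p) (vertex-avoidingPerm q)) ⟩
  count312 (join (vertex p) (vertex q))
    ≡⟨ count312-split (vertex p) (vertex q) (AvoidingPerm.bounded (vertex-avoidingPerm q))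
                      (vertex≢[] p) (vertex≢[] q) ⟩
  suc (count312 (vertex p) + count312 (vertex q))
    ≡⟨ cong₂ (λ a b → suc (a + b)) (count312-vertex p) (count312-vertex q) ⟩
  1 ∎
  where open ≡-Reasoning

faceWord≢[] : ∀ u p q → faceWord u p q ≢ []
faceWord≢[] []      p q = join≢[] (vertex p) (vertex q)
faceWord≢[] (b ∷ u) p q = step≢[] b (faceWord u p q)

data StepView : List ℕ → Set where
  stepped : ∀ b {x L} → AvoidingPerm (x ∷ L) → StepView (step b (x ∷ L))
  halves  : ∀ {a α b β} → AvoidingPerm (a ∷ α) → AvoidingPerm (b ∷ β) →
            StepView (join (a ∷ α) (b ∷ β))

stepView : ∀ {L} → AvoidingPerm L → 2 ≤ length L → StepView L
stepView p 2≤n with joinView p (<-≤-trans z<s 2≤n)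
... | join-view {[]}    {[]}    _  _  = contradiction 2≤n λ { (s≤s ()) }
... | join-view {_ ∷ _} {[]}    pα _  = stepped true pα
... | join-view {[]}    {_ ∷ _} _  pβ = stepped false pβ
... | join-view {_ ∷ _} {_ ∷ _} pα pβ = halves pα pβ

vertex-surjective : ∀ d {L} → AvoidingPerm L → count312 L ≡ 0 → length L ≡ suc d →
                    ∃[ v ] vertex v ≡ L
vertex-surjective zero    {0 ∷ []}     _                                  _    _   = [] , refl
vertex-surjective zero    {suc _ ∷ []} (mkAvoidingPerm _ (s≤s () ∷ []) _) _    _
vertex-surjective (suc d) {L}          p                                  none len
  with stepView p (subst (2 ≤_) (sym len) (s≤s (s≤s z≤n)))
... | stepped b {x} {L′} pL′ =
  let v , eq = vertex-surjective d pL′ (trans (sym (count312-step b pL′)) none)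
                                 (suc-injective (trans (sym (length-step b (x ∷ L′))) len))
  in b ∷ v , cong (step b) eq
... | halves {a} {α} {b} {β} pα pβ = contradiction (trans (sym split) none) λ ()
  where
  split : count312 (join (a ∷ α) (b ∷ β)) ≡ suc (count312 (a ∷ α) + count312 (b ∷ β))
  split = count312-split (a ∷ α) (b ∷ β) (AvoidingPerm.bounded pβ) (λ ()) (λ ())

faceWord-surjective : ∀ d {L} → AvoidingPerm L → count312 L ≡ 1 → length L ≡ suc d →
                      ∃[ u ] ∃[ p ] ∃[ q ] faceWord u p q ≡ L
faceWord-surjective zero    {_ ∷ []} _ ()  _
faceWord-surjective (suc d) {L}      p one len
  with stepView p (subst (2 ≤_) (sym len) (s≤s (s≤s z≤n)))
... | stepped b {x} {L′} pL′ =
  let u , p , q , eq = faceWord-surjective d pL′ (trans (sym (count312-step b pL′)) one)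
                                           (suc-injective (trans (sym (length-step b (x ∷ L′))) len))
  in b ∷ u , p , q , cong (step b) eq
... | halves {a} {α} {b} {β} pα pβ =
  let none = suc-injective (trans (sym split) one)
      p , eqα = vertex-surjective (length α) pα (m+n≡0⇒m≡0 _ none) refl
      q , eqβ = vertex-surjective (length β) pβ (m+n≡0⇒n≡0 (count312 (a ∷ α)) none) refl
  in [] , p , q , cong₂ join eqα eqβ
  where
  split : count312 (join (a ∷ α) (b ∷ β)) ≡ suc (count312 (a ∷ α) + count312 (b ∷ β))
  split = count312-split (a ∷ α) (b ∷ β) (AvoidingPerm.bounded pβ) (λ ()) (λ ())

decodeVertex : ℕ → List ℕ → List Bool
decodeVertex zero    _ = []
decodeVertex (suc d) L with unjoin L
... | α , [] = true  ∷ decodeVertex d α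
... | _ , β  = false ∷ decodeVertex d β

-- For b = false, unjoin computes on the leading 0, leaving map (_∸ 1) (map suc L) to simplify.
decodeVertex-step : ∀ d b {L} → L ≢ [] → decodeVertex (suc d) (step b L) ≡ b ∷ decodeVertex d L
decodeVertex-step d true  {L}     _    rewrite unjoin-join L [] = refl
decodeVertex-step d false {[]}    L≢[] = ⊥-elim (L≢[] refl)
decodeVertex-step d false {x ∷ L} _    =
  cong (λ L′ → false ∷ decodeVertex d L′) (unshift-shift 1 (x ∷ L))

decodeVertex-vertex : ∀ v → decodeVertex (length v) (vertex v) ≡ v
decodeVertex-vertex []      = refl
decodeVertex-vertex (b ∷ v) =
  trans (decodeVertex-step (length v) b (vertex≢[] v)) (cong (b ∷_) (decodeVertex-vertex v))

faceStar : List Bool → List Bool → List Bool → List (Maybe Bool)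
faceStar u p q = map just u ++ nothing ∷ map just p ++ nothing ∷ map just q

freeCount-fixed++ : ∀ p t → freeCount (fromList (map just p ++ t)) ≡ freeCount (fromList t)
freeCount-fixed++ []      t = refl
freeCount-fixed++ (b ∷ p) t = freeCount-fixed++ p t

freeCount-fixed : ∀ q → freeCount (fromList (map just q)) ≡ 0
freeCount-fixed []      = refl
freeCount-fixed (b ∷ q) = freeCount-fixed q

freeCount-faceStar : ∀ u p q → freeCount (fromList (faceStar u p q)) ≡ 2
freeCount-faceStar u p q =
  trans (freeCount-fixed++ u _)
        (cong suc (trans (freeCount-fixed++ p _) (cong suc (freeCount-fixed q))))

freeCount≡0⇒map-just : ∀ s → freeCount (fromList s) ≡ 0 → ∃[ q ] s ≡ map just q
freeCount≡0⇒map-just []           _ = [] , refl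
freeCount≡0⇒map-just (just b ∷ s) h =
  let q , eq = freeCount≡0⇒map-just s h in b ∷ q , cong (just b ∷_) eq

freeCount≡1⇒map-just-++ : ∀ s → freeCount (fromList s) ≡ 1 →
                          ∃[ p ] ∃[ q ] s ≡ map just p ++ nothing ∷ map just q
freeCount≡1⇒map-just-++ (nothing ∷ s) h =
  let q , eq = freeCount≡0⇒map-just s (suc-injective h) in [] , q , cong (nothing ∷_) eq
freeCount≡1⇒map-just-++ (just b ∷ s)  h =
  let p , q , eq = freeCount≡1⇒map-just-++ s h in b ∷ p , q , cong (just b ∷_) eq

freeCount≡2⇒faceStar : ∀ s → freeCount (fromList s) ≡ 2 → ∃[ u ] ∃[ p ] ∃[ q ] s ≡ faceStar u p q
freeCount≡2⇒faceStar (nothing ∷ s) h =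
  let p , q , eq = freeCount≡1⇒map-just-++ s (suc-injective h) in [] , p , q , cong (nothing ∷_) eq
freeCount≡2⇒faceStar (just b ∷ s)  h =
  let u , p , q , eq = freeCount≡2⇒faceStar s h in b ∷ u , p , q , cong (just b ∷_) eq

catMaybes-map-just : ∀ {X : Set} (xs : List X) → catMaybes (map just xs) ≡ xs
catMaybes-map-just []       = refl
catMaybes-map-just (x ∷ xs) = cong (x ∷_) (catMaybes-map-just xs)

splitAtFree : List (Maybe Bool) → List Bool × List Bool
splitAtFree []            = [] , []
splitAtFree (nothing ∷ s) = [] , catMaybes s
splitAtFree (just b ∷ s)  = Prod.map₁ (b ∷_) (splitAtFree s)

splitAtFree-++ : ∀ p q → splitAtFree (map just p ++ nothing ∷ map just q) ≡ (p , q)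
splitAtFree-++ []      q = cong ([] ,_) (catMaybes-map-just q)
splitAtFree-++ (b ∷ p) q = cong (Prod.map₁ (b ∷_)) (splitAtFree-++ p q)

encodeFace : List (Maybe Bool) → List ℕ
encodeFace []            = 0 ∷ []
encodeFace (just b ∷ s)  = step b (encodeFace s)
encodeFace (nothing ∷ s) = let p , q = splitAtFree s in join (vertex p) (vertex q)

encodeFace-faceStar : ∀ u p q → encodeFace (faceStar u p q) ≡ faceWord u p q
encodeFace-faceStar []      p q = cong (λ (p′ , q′) → join (vertex p′) (vertex q′)) (splitAtFree-++ p q)
encodeFace-faceStar (b ∷ u) p q = cong (step b) (encodeFace-faceStar u p q)

length-faceWord : ∀ u p q → length (faceWord u p q) ≡ suc (length (faceStar u p q))
length-faceWord (b ∷ u) p q =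
  trans (length-step b (faceWord u p q)) (cong suc (length-faceWord u p q))
length-faceWord []      p q = begin
  length (join (vertex p) (vertex q))
    ≡⟨ length-join (vertex p) (vertex q) ⟩
  length (vertex p) + suc (length (vertex q))
    ≡⟨ cong₂ (λ a b → a + suc b) (length-vertex p) (length-vertex q) ⟩
  suc (length p + suc (suc (length q)))
    ≡⟨ cong suc (+-suc (length p) (suc (length q))) ⟩
  suc (suc (length p + suc (length q)))
    ≡⟨ cong (suc ∘ suc) (sym length-pq) ⟩
  suc (length (faceStar [] p q)) ∎
  where
  open ≡-Reasoning
  length-pq : length (map just p ++ nothing ∷ map just q) ≡ length p + suc (length q)
  length-pq = trans (length-++ (map just p))
                    (cong₂ (λ a b → a + suc b) (length-map just p) (length-map just q))

decodeFace : ℕ → List ℕ → List (Maybe Bool)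
decodeFace zero    _ = []
decodeFace (suc d) L with unjoin L
... | α     , []    = just true  ∷ decodeFace d α
... | []    , β     = just false ∷ decodeFace d β
... | a ∷ α , b ∷ β = faceStar [] (decodeVertex (length α) (a ∷ α)) (decodeVertex (length β) (b ∷ β))

decodeFace-step : ∀ d b {L} → L ≢ [] → decodeFace (suc d) (step b L) ≡ just b ∷ decodeFace d L
decodeFace-step d true  {L}     _    rewrite unjoin-join L [] = refl
decodeFace-step d false {[]}    L≢[] = ⊥-elim (L≢[] refl)
decodeFace-step d false {x ∷ L} _    =
  cong (λ L′ → just false ∷ decodeFace d L′) (unshift-shift 1 (x ∷ L))

decodeFace-join : ∀ d {α β} → α ≢ [] → β ≢ [] →
                  decodeFace (suc d) (join α β)
                    ≡ faceStar [] (decodeVertex (pred (length α)) α) (decodeVertex (pred (length β)) β)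
decodeFace-join d {[]}    {_}     α≢[] _    = ⊥-elim (α≢[] refl)
decodeFace-join d {_ ∷ _} {[]}    _    β≢[] = ⊥-elim (β≢[] refl)
decodeFace-join d {a ∷ α} {b ∷ β} _    _    rewrite unjoin-join (a ∷ α) (b ∷ β) = refl

decodeFace-faceWord : ∀ u p q → decodeFace (length (faceStar u p q)) (faceWord u p q) ≡ faceStar u p q
decodeFace-faceWord []      p q
  rewrite decodeFace-join (length (map just p ++ nothing ∷ map just q)) (vertex≢[] p) (vertex≢[] q)
        | length-vertex p | length-vertex q | decodeVertex-vertex p | decodeVertex-vertex q = refl
decodeFace-faceWord (b ∷ u) p q =
  trans (decodeFace-step _ b (faceWord≢[] u p q)) (cong (just b ∷_) (decodeFace-faceWord u p q))

IsFaceStar : ℕ → List (Maybe Bool) → Set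
IsFaceStar d s = length s ≡ d × freeCount (fromList s) ≡ 2

IsFaceWord : ℕ → List ℕ → Set
IsFaceWord m L = length L ≡ m × AvoidingPerm L × count312 L ≡ 1

encodeFace-isFaceWord : ∀ {d} s → IsFaceStar d s → IsFaceWord (suc d) (encodeFace s)
encodeFace-isFaceWord s (len , two) with freeCount≡2⇒faceStar s two
... | u , p , q , refl rewrite encodeFace-faceStar u p q =
  trans (length-faceWord u p q) (cong suc len) , faceWord-avoidingPerm u p q , count312-faceWord u p q

decodeFace-encodeFace : ∀ {d} s → IsFaceStar d s → decodeFace d (encodeFace s) ≡ s
decodeFace-encodeFace s (refl , two) with freeCount≡2⇒faceStar s two
... | u , p , q , refl rewrite encodeFace-faceStar u p q = decodeFace-faceWord u p q

encodeFace-surjective : ∀ {d} L → IsFaceWord (suc d) L → ∃[ s ] IsFaceStar d s × encodeFace s ≡ L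
encodeFace-surjective {d} L (len , perm , one) with faceWord-surjective d perm one len
... | u , p , q , refl =
  faceStar u p q ,
  (suc-injective (trans (sym (length-faceWord u p q)) len) , freeCount-faceStar u p q) ,
  encodeFace-faceStar u p q

decodeFace-isFaceStar : ∀ {d} L → IsFaceWord (suc d) L → IsFaceStar d (decodeFace d L)
decodeFace-isFaceStar {d} L w with encodeFace-surjective L w
... | s , face , refl = subst (IsFaceStar d) (sym (decodeFace-encodeFace s face)) face

encodeFace-decodeFace : ∀ {d} L → IsFaceWord (suc d) L → encodeFace (decodeFace d L) ≡ L
encodeFace-decodeFace L w with encodeFace-surjective L w
... | s , face , refl = cong encodeFace (decodeFace-encodeFace s face)

-- The invariants are stored irrelevantly, so the inverse laws, which need them, are recomputed
-- from the decidability of equality of lists.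
faceStars↔faceWords : ∀ d →
  [ s ∈ List (Maybe Bool) ∣ IsFaceStar d s ] ↔ [ L ∈ List ℕ ∣ IsFaceWord (suc d) L ]
faceStars↔faceWords d =
  mk↔ₛ′ (Refinement.map encodeFace λ {s} → encodeFace-isFaceWord s)
        (Refinement.map (decodeFace d) λ {L} → decodeFace-isFaceStar L)
        (λ (L , [ w ]) → value-injective
           (recompute (List.≡-dec _≟_ _ L) (encodeFace-decodeFace L w)))
        (λ (s , [ f ]) → value-injective
           (recompute (List.≡-dec (Maybe.≡-dec Bool._≟_) _ s) (decodeFace-encodeFace s f)))

-- Words over Fin m as vectors

letters : ∀ {m n} → Vec (Fin m) n → List ℕ
letters w = map toℕ (toList w)

-- Contains213 and Occ312 of Defs for words of any length n, so that they can be handled by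
-- induction on the word; for n = m they are the notions of Defs.
Contains213ⱽ : ∀ {m n} → Vec (Fin m) n → Set
Contains213ⱽ {n = n} π =
  Σ (Fin n) λ i → Σ (Fin n) λ j → Σ (Fin n) λ l →
    (toℕ i < toℕ j) × (toℕ j < toℕ l) ×
    (toℕ (lookup π j) < toℕ (lookup π i)) × (toℕ (lookup π i) < toℕ (lookup π l))

Occ312ⱽ : ∀ {m n} → Vec (Fin m) n → Fin n → Set
Occ312ⱽ {n = n} π a =
  Σ (Fin n) λ b → Σ (Fin n) λ c →
    (toℕ b ≡ suc (toℕ a)) × (toℕ c ≡ suc (toℕ b)) ×
    (toℕ (lookup π b) < toℕ (lookup π c)) × (toℕ (lookup π c) < toℕ (lookup π a))

Unique-toList⁺ : ∀ {X : Set} {n} {v : Vec X n} → Vec.Unique v → Unique (toList v)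
Unique-toList⁺ []       = []
Unique-toList⁺ (x∉ ∷ u) = VecAll.toList⁺ x∉ ∷ Unique-toList⁺ u

Unique-toList⁻ : ∀ {X : Set} {n} (v : Vec X n) → Unique (toList v) → Vec.Unique v
Unique-toList⁻ []      []       = []
Unique-toList⁻ (x ∷ v) (x∉ ∷ u) = VecAll.toList⁻ x∉ ∷ Unique-toList⁻ v u

module _ {m : ℕ} where

  Any<-letters⁺ : ∀ {n} x (w : Vec (Fin m) n) l → x < toℕ (lookup w l) → Any (x <_) (letters w)
  Any<-letters⁺ x (_ ∷ w) fzero    x<  = here x<
  Any<-letters⁺ x (_ ∷ w) (fsuc l) x<  = there (Any<-letters⁺ x w l x<)

  Any<-letters⁻ : ∀ {n} x (w : Vec (Fin m) n) → Any (x <_) (letters w) → ∃[ l ] x < toℕ (lookup w l)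
  Any<-letters⁻ x (_ ∷ w) (here x<)  = fzero , x<
  Any<-letters⁻ x (_ ∷ w) (there x<) = let l , x<wl = Any<-letters⁻ x w x< in fsuc l , x<wl

  Completes213-letters⁺ : ∀ {n} x (w : Vec (Fin m) n) j l → toℕ j < toℕ l →
                          toℕ (lookup w j) < x → x < toℕ (lookup w l) → Completes213 x (letters w)
  Completes213-letters⁺ x (_ ∷ w) fzero    (fsuc l) _         wj<x x<wl =
    inj₁ (wj<x , Any<-letters⁺ x w l x<wl)
  Completes213-letters⁺ x (_ ∷ w) (fsuc j) (fsuc l) (s≤s j<l) wj<x x<wl =
    inj₂ (Completes213-letters⁺ x w j l j<l wj<x x<wl)

  Completes213-letters⁻ : ∀ {n} x (w : Vec (Fin m) n) → Completes213 x (letters w) →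
                          ∃[ j ] ∃[ l ] toℕ j < toℕ l × toℕ (lookup w j) < x × x < toℕ (lookup w l)
  Completes213-letters⁻ x (_ ∷ w) (inj₁ (wj<x , x<w)) =
    let l , x<wl = Any<-letters⁻ x w x<w in fzero , fsuc l , z<s , wj<x , x<wl
  Completes213-letters⁻ x (_ ∷ w) (inj₂ c) =
    let j , l , j<l , wj<x , x<wl = Completes213-letters⁻ x w c in fsuc j , fsuc l , s<s j<l , wj<x , x<wl

  Has213-letters⁺ : ∀ {n} (w : Vec (Fin m) n) → Contains213ⱽ w → Has213 (letters w)
  Has213-letters⁺ (x ∷ w) (fzero , fsuc j , fsuc l , _ , s≤s j<l , wj<wi , wi<wl) =
    inj₁ (Completes213-letters⁺ (toℕ x) w j l j<l wj<wi wi<wl)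
  Has213-letters⁺ (_ ∷ w) (fsuc i , fsuc j , fsuc l , s≤s i<j , s≤s j<l , wj<wi , wi<wl) =
    inj₂ (Has213-letters⁺ w (i , j , l , i<j , j<l , wj<wi , wi<wl))

  Has213-letters⁻ : ∀ {n} (w : Vec (Fin m) n) → Has213 (letters w) → Contains213ⱽ w
  Has213-letters⁻ (x ∷ w) (inj₁ c) =
    let j , l , j<l , wj<x , x<wl = Completes213-letters⁻ (toℕ x) w c
    in fzero , fsuc j , fsuc l , z<s , s<s j<l , wj<x , x<wl
  Has213-letters⁻ (_ ∷ w) (inj₂ h) =
    let i , j , l , i<j , j<l , wj<wi , wi<wl = Has213-letters⁻ w h
    in fsuc i , fsuc j , fsuc l , s<s i<j , s<s j<l , wj<wi , wi<wl

  Occ312-letters⁺ : ∀ {n} (w : Vec (Fin m) n) a → Occ312ⱽ w a →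
                    Starts312 (drop (toℕ a) (letters w))
  Occ312-letters⁺ (_ ∷ _ ∷ _ ∷ _) fzero    (fsuc fzero , fsuc (fsuc fzero) , refl , refl , o) = o
  Occ312-letters⁺ (_ ∷ _)         fzero    (fsuc (fsuc _) , _ , () , _)
  Occ312-letters⁺ (_ ∷ _)         fzero    (fsuc fzero , fsuc fzero , _ , () , _)
  Occ312-letters⁺ (_ ∷ _)         fzero    (fsuc fzero , fsuc (fsuc (fsuc _)) , _ , () , _)
  Occ312-letters⁺ (_ ∷ w)         (fsuc a) (fsuc b , fsuc c , b≡ , c≡ , o) =
    Occ312-letters⁺ w a (b , c , suc-injective b≡ , suc-injective c≡ , o)

  Occ312-letters⁻ : ∀ {n} (w : Vec (Fin m) n) k → Starts312 (drop k (letters w)) →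
                    ∃[ a ] toℕ a ≡ k × Occ312ⱽ w a
  Occ312-letters⁻ (_ ∷ _ ∷ _ ∷ _) zero    o =
    fzero , refl , fsuc fzero , fsuc (fsuc fzero) , refl , refl , o
  Occ312-letters⁻ (_ ∷ w)         (suc k) o =
    let a , a≡k , b , c , b≡ , c≡ , o′ = Occ312-letters⁻ w k o
    in fsuc a , cong suc a≡k , fsuc b , fsuc c , cong suc b≡ , cong suc c≡ , o′

  length-letters : ∀ {n} (w : Vec (Fin m) n) → length (letters w) ≡ n
  length-letters w = trans (length-map toℕ (toList w)) (length-toList w)

  letters-bounded : ∀ {n} (w : Vec (Fin m) n) → All (_< m) (letters w)
  letters-bounded w = All.map⁺ (All.universal toℕ<n (toList w))

  letters-injective : ∀ {n} {v w : Vec (Fin m) n} → letters v ≡ letters w → v ≡ w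
  letters-injective {v = v} {w} eq =
    trans (sym (cast-is-id refl v)) (toList-injective refl v w (List.map-injective toℕ-injective eq))

  ExactlyOne312⇒ : (w : Vec (Fin m) m) → ExactlyOne312 w → ExactlyOne (Occurs312At (letters w))
  ExactlyOne312⇒ w (a , o , unique) =
    toℕ a , Occ312-letters⁺ w a o ,
    λ k o′ → let a′ , a′≡k , o″ = Occ312-letters⁻ w k o′
             in trans (sym a′≡k) (cong toℕ (unique a′ o″))

  ⇒ExactlyOne312 : (w : Vec (Fin m) m) → ExactlyOne (Occurs312At (letters w)) → ExactlyOne312 w
  ⇒ExactlyOne312 w (k , o , unique) =
    let a , a≡k , oa = Occ312-letters⁻ w k o
    in a , oa ,
       λ a′ o′ → toℕ-injective (trans (unique (toℕ a′) (Occ312-letters⁺ w a′ o′)) (sym a≡k))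

  letters-isFaceWord : (w : Vec (Fin m) m) → IsPerm w → Avoids213 w → ExactlyOne312 w →
                       IsFaceWord m (letters w)
  letters-isFaceWord w u ¬213 one =
    length-letters w ,
    mkAvoidingPerm (Unique.map⁺ toℕ-injective (Unique-toList⁺ u))
                   (subst (λ n → All (_< n) (letters w)) (sym (length-letters w)) (letters-bounded w))
                   (¬213 ∘ Has213-letters⁻ w) ,
    unique312⇒count312≡1 (letters w) (ExactlyOne312⇒ w one)

  isFaceWord⇒ : (w : Vec (Fin m) m) → IsFaceWord m (letters w) →
                IsPerm w × Avoids213 w × ExactlyOne312 w
  isFaceWord⇒ w (_ , mkAvoidingPerm u _ ¬213 , one) =
    Unique-toList⁻ w (Unique.map⁻ u) , ¬213 ∘ Has213-letters⁺ w ,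
    ⇒ExactlyOne312 w (count312≡1⇒unique312 _ one)

  module _ .{{_ : NonZero m}} where

    -- Letters ≥ m, which do not occur in the words considered, are reduced mod m.
    wordOf : (L : List ℕ) → .(length L ≡ m) → Vec (Fin m) m
    wordOf L len = cast len (Vec.map (_mod m) (fromList L))

    letters-wordOf : ∀ {L} .(len : length L ≡ m) → All (_< m) L → letters (wordOf L len) ≡ L
    letters-wordOf {L} len L<m = begin
      map toℕ (toList (cast len (Vec.map (_mod m) (fromList L))))
        ≡⟨ cong (map toℕ) (toList-cast len _) ⟩
      map toℕ (toList (Vec.map (_mod m) (fromList L)))
        ≡⟨ cong (map toℕ) (toList-map _ (fromList L)) ⟩
      map toℕ (map (_mod m) (toList (fromList L)))
        ≡⟨ cong (map toℕ ∘ map (_mod m)) (toList∘fromList L) ⟩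
      map toℕ (map (_mod m) L)
        ≡⟨ sym (map-∘ L) ⟩
      map (λ x → toℕ (x mod m)) L
        ≡⟨ map-id-local (All.map toℕ-mod L<m) ⟩
      L ∎
      where
      open ≡-Reasoning
      toℕ-mod : ∀ {x} → x < m → toℕ (x mod m) ≡ x
      toℕ-mod x<m = trans (toℕ-fromℕ< _) (m<n⇒m%n≡m x<m)

    isFaceWord-bounded : ∀ {L} → IsFaceWord m L → All (_< m) L
    isFaceWord-bounded (len , perm , _) = subst (λ n → All (_< n) _) len (AvoidingPerm.bounded perm)

    wordOf-isFaceWord : ∀ {L} (f : IsFaceWord m L) → IsFaceWord m (letters (wordOf L (proj₁ f)))
    wordOf-isFaceWord f = subst (IsFaceWord m) (sym (letters-wordOf (proj₁ f) (isFaceWord-bounded f))) f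

word-injective : ∀ {m} {P Q : Perm213One312 m} → Perm213One312.word P ≡ Perm213One312.word Q → P ≡ Q
word-injective {P = mkP _ _ _ _} {mkP _ _ _ _} refl = refl

perms↔faceWords : ∀ m .{{_ : NonZero m}} → Perm213One312 m ↔ [ L ∈ List ℕ ∣ IsFaceWord m L ]
perms↔faceWords m = mk↔ₛ′ to from to∘from from∘to
  where
  to : Perm213One312 m → [ L ∈ List ℕ ∣ IsFaceWord m L ]
  to (mkP w u ¬213 one) = letters w , [ letters-isFaceWord w u ¬213 one ]
  from : [ L ∈ List ℕ ∣ IsFaceWord m L ] → Perm213One312 m
  from (L , [ f ]) =
    mkP (wordOf L (proj₁ f)) (proj₁ (props f)) (proj₁ (proj₂ (props f))) (proj₂ (proj₂ (props f)))
    where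
    props : (f : IsFaceWord m L) → let w = wordOf L (proj₁ f) in IsPerm w × Avoids213 w × ExactlyOne312 w
    props f = isFaceWord⇒ _ (wordOf-isFaceWord f)
  to∘from : ∀ x → to (from x) ≡ x
  to∘from (L , [ f ]) =
    value-injective (letters-wordOf (proj₁ f) (recompute (All.all? (_<? m) L) (isFaceWord-bounded f)))
  from∘to : ∀ P → from (to P) ≡ P
  from∘to (mkP w _ _ _) =
    word-injective (letters-injective (letters-wordOf (length-letters w) (letters-bounded w)))

freeCount-resp-toList : ∀ {m n} (v : Vec (Maybe Bool) m) (w : Vec (Maybe Bool) n) →
                        toList v ≡ toList w → freeCount v ≡ freeCount w
freeCount-resp-toList []            []      _  = refl
freeCount-resp-toList (nothing ∷ v) (_ ∷ w) eq with refl ← List.∷-injectiveˡ eq =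
  cong suc (freeCount-resp-toList v w (List.∷-injectiveʳ eq))
freeCount-resp-toList (just _ ∷ v)  (_ ∷ w) eq with refl ← List.∷-injectiveˡ eq =
  freeCount-resp-toList v w (List.∷-injectiveʳ eq)

star-injective : ∀ {d} {F G : Face2 d} → Face2.star F ≡ Face2.star G → F ≡ G
star-injective {F = mkF _ _} {mkF _ _} refl = refl

faces↔faceStars : ∀ d → Face2 d ↔ [ s ∈ List (Maybe Bool) ∣ IsFaceStar d s ]
faces↔faceStars d = mk↔ₛ′ to from to∘from from∘to
  where
  to : Face2 d → [ s ∈ List (Maybe Bool) ∣ IsFaceStar d s ]
  to (mkF v two) =
    toList v , [ length-toList v , trans (freeCount-resp-toList _ v (toList∘fromList (toList v))) two ]
  from : [ s ∈ List (Maybe Bool) ∣ IsFaceStar d s ] → Face2 d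
  from (s , [ f ]) =
    mkF (cast (proj₁ f) (fromList s))
        (trans (freeCount-resp-toList _ (fromList s) (toList-cast (proj₁ f) _)) (proj₂ f))
  to∘from : ∀ x → to (from x) ≡ x
  to∘from (s , [ f ]) = value-injective (trans (toList-cast (proj₁ f) (fromList s)) (toList∘fromList s))
  from∘to : ∀ F → from (to F) ≡ F
  from∘to (mkF v _) = star-injective (fromList∘toList v)

mainTheorem11 : (n : ℕ) → Face2 (suc n) ↔ Perm213One312 (suc (suc n))
mainTheorem11 n =
  ↔-trans (faces↔faceStars (suc n))
          (↔-trans (faceStars↔faceWords (suc n)) (↔-sym (perms↔faceWords (suc (suc n)))))
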